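{- For every DHS $G$, dynamic sequent $X$, list of announcements $\alpha$, formula $A$ and finite multisets $M,N$, the dynamic hypersequent $G \mid X /\!/_\alpha A, M \Rightarrow N, A$ is derivable in $\mathbf{DHS}_{PAL}$.
   Context: Formulas of $\mathcal{L}_{PAL}$ are generated by $A ::= p \mid \neg A \mid (A\wedge A) \mid \Box A \mid [A]A$ from a countable set of atoms. A list of announcements is a finite (possibly empty, $\epsilon$) sequence of formulas, $\alpha\cdot A$ its extension by $A$. A sequent is $M\Rightarrow N$ ($M,N$ finite multisets); $A,\Gamma$ / $\Gamma,A$ add $A$ to antecedent / succedent. A dynamic sequent is $/\!/_{\alpha_1}\Gamma_1/\!/\cdots/\!/_{\alpha_n}\Gamma_n$ (components labelled by lists of announcements; $/\!/_\epsilon\Gamma$ written $\Gamma$); a DHS is $X_1\mid\cdots\mid X_n$ of dynamic sequents. $G\mid X/\!/_\alpha M\Rightarrow N$ denotes a DHS with a dynamic sequent having component labelled $\alpha$ equal to $M\Rightarrow N$, $X$ the rest of that dynamic sequent and $G$ the rest of the DHS (possibly empty). Calculus $\mathbf{DHS}_{PAL}$ (notation "premises / conclusion"): Axioms $G\mid X/\!/_\alpha p,M\Rightarrow N,p$. (L$\neg$) $G\mid X/\!/_\alpha M\Rightarrow N,A$ / $G\mid X/\!/_\alpha\neg A,M\Rightarrow N$; (R$\neg$) $G\mid X/\!/_\alpha A,M\Rightarrow N$ / $G\mid X/\!/_\alpha M\Rightarrow N,\neg A$; (L$\wedge$) $G\mid X/\!/_\alpha A,B,M\Rightarrow N$ /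 $G\mid X/\!/_\alpha A\wedge B,M\Rightarrow N$; (R$\wedge$) $G\mid X/\!/_\alpha M\Rightarrow N,A$ and $G\mid X/\!/_\alpha M\Rightarrow N,B$ / $G\mid X/\!/_\alpha M\Rightarrow N,A\wedge B$; (L$\Box_1$) $G\mid X/\!/_\alpha\Box A,A,M\Rightarrow N$ / $G\mid X/\!/_\alpha\Box A,M\Rightarrow N$; (R$\Box$) $G\mid X/\!/_\alpha M\Rightarrow N\mid/\!/_\alpha\Rightarrow A$ / $G\mid X/\!/_\alpha M\Rightarrow N,\Box A$; (L$\Box_2$) $G\mid X/\!/_\alpha\Box A,M\Rightarrow N\mid Y/\!/_\alpha A,P\Rightarrow Q$ / $G\mid X/\!/_\alpha\Box A,M\Rightarrow N\mid Y/\!/_\alpha P\Rightarrow Q$; (L$\Box_3$) with $\beta=B_1\cdots B_n$, $\overline{Y}=Y/\!/_{\alpha\cdot\beta}\Box A,\Delta$: premises $G\mid X/\!/_\alpha\Gamma,B_1\mid\overline{Y}$, $G\mid X/\!/_\alpha\Gamma/\!/_{\alpha\cdot B_1\cdots B_i}\Rightarrow B_{i+1}\mid\overline{Y}$ ($1\le i<n$), $G\mid X/\!/_\alpha\Gamma/\!/_{\alpha\cdot\beta}A\Rightarrow\ \mid\overline{Y}$, conclusion $G\mid X/\!/_\alpha\Gamma\mid Y/\!/_{\alpha\cdot\beta}\Box A,\Delta$; (L$[\cdot]$) $G\mid X/\!/_\alpha M\Rightarrow N,A/\!/_{\alpha\cdot A}M'\Rightarrow N'$ and $G\mid X/\!/_\alpha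 M\Rightarrow N/\!/_{\alpha\cdot A}B,M'\Rightarrow N'$ / $G\mid X/\!/_\alpha[A]B,M\Rightarrow N/\!/_{\alpha\cdot A}M'\Rightarrow N'$; (R$[\cdot]$) $G\mid X/\!/_\alpha A,M\Rightarrow N/\!/_{\alpha\cdot A}M'\Rightarrow N',B$ / $G\mid X/\!/_\alpha M\Rightarrow N,[A]B/\!/_{\alpha\cdot A}M'\Rightarrow N'$ (in both, if no $\alpha\cdot A$ component is in the conclusion, the premises — for (L$[\cdot]$) the right one — contain a new component $/\!/_{\alpha\cdot A}$ with $M',N'$ empty); (Lat) $G\mid X/\!/_\alpha p,M\Rightarrow N/\!/_{\alpha\cdot A}p,M'\Rightarrow N'$ / $G\mid X/\!/_\alpha M\Rightarrow N/\!/_{\alpha\cdot A}p,M'\Rightarrow N'$; (Rat) $G\mid X/\!/_\alpha M\Rightarrow N,p/\!/_{\alpha\cdot A}M'\Rightarrow N',p$ / $G\mid X/\!/_\alpha M\Rightarrow N/\!/_{\alpha\cdot A}M'\Rightarrow N',p$; (New) $G\mid X/\!/_\alpha\Rightarrow\ /\!/_{\alpha\cdot A}M\Rightarrow N$ / $G\mid X/\!/_{\alpha\cdot A}M\Rightarrow N$; (Recall) $G\mid X/\!/_\alpha A,M\Rightarrow N/\!/_{\alpha\cdot A}M'\Rightarrow N'$ / $G\mid X/\!/_\alpha M\Rightarrow N/\!/_{\alpha\cdot A}M'\Rightarrow N'$. -}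

module Defs where

open import Data.Nat using (ℕ)
open import Data.List using (List; []; _∷_; [_]; _++_; _∷ʳ_)
open import Data.List.Relation.Unary.All using (All)
open import Data.List.Membership.Propositional using (_∈_)
open import Data.List.Relation.Binary.Permutation.Propositional using (_↭_)
import Data.List.Relation.Binary.Permutation.Homogeneous as PermH
open import Data.Product using (_×_; _,_; proj₁)
open import Relation.Binary.PropositionalEquality using (_≡_; _≢_)

data Fm : Set where
  at    : ℕ → Fm
  ¬ᶠ_   : Fm → Fm
  _∧ᶠ_  : Fm → Fm → Fm
  □_    : Fm → Fm
  ⟦_⟧_  : Fm → Fm → Fm

infixr 6 _∧ᶠ_
infix 7 ¬ᶠ_ □_ ⟦_⟧_

-- lists of announcements; α · A is  α ∷ʳ A  (extension at the end)
Label : Set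
Label = List Fm

-- sequents M ⇒ N, multisets represented as lists (identified up to ↭ below)
infix 5 _⇒_
data Seq : Set where
  _⇒_ : List Fm → List Fm → Seq

Comp : Set
Comp = Label × Seq

Dyn : Set
Dyn = List Comp

DHS : Set
DHS = List Dyn

data SeqEq : Seq → Seq → Set where
  seqEq : ∀ {M M' N N'} → M ↭ M' → N ↭ N' → SeqEq (M ⇒ N) (M' ⇒ N')

data CompEq : Comp → Comp → Set where
  compEq : ∀ {α s t} → SeqEq s t → CompEq (α , s) (α , t)

DynEq : Dyn → Dyn → Set
DynEq = PermH.Permutation CompEq

DHSEq : DHS → DHS → Set
DHSEq = PermH.Permutation DynEq

-- the (label, goal) pairs  (α·B₁, B₂), (α·B₁B₂, B₃), …  for the middle premises of (L□₃)
prefixGoals : Label → List Fm → List (Label × Fm)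
prefixGoals γ [] = []
prefixGoals γ (B ∷ Bs) = (γ , B) ∷ prefixGoals (γ ∷ʳ B) Bs

NoLabel : Label → Dyn → Set
NoLabel γ X = All (λ c → proj₁ c ≢ γ) X

-- The displayed components/dynamic sequents are at
-- the front of the lists; the rule `perm` makes derivability invariant under
-- the multiset reading (so position is immaterial).
data Der : DHS → Set where
  perm : ∀ {H H'} → Der H → DHSEq H H' → Der H'

  ax : ∀ {G X α p M N} →
    Der (((α , (at p ∷ M) ⇒ (at p ∷ N)) ∷ X) ∷ G)

  L¬ : ∀ {G X α A M N} →
    Der (((α , M ⇒ (A ∷ N)) ∷ X) ∷ G) →
    Der (((α , ((¬ᶠ A) ∷ M) ⇒ N) ∷ X) ∷ G)

  R¬ : ∀ {G X α A M N} →
    Der (((α , (A ∷ M) ⇒ N) ∷ X) ∷ G) →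
    Der (((α , M ⇒ ((¬ᶠ A) ∷ N)) ∷ X) ∷ G)

  L∧ : ∀ {G X α A B M N} →
    Der (((α , (A ∷ B ∷ M) ⇒ N) ∷ X) ∷ G) →
    Der (((α , ((A ∧ᶠ B) ∷ M) ⇒ N) ∷ X) ∷ G)

  R∧ : ∀ {G X α A B M N} →
    Der (((α , M ⇒ (A ∷ N)) ∷ X) ∷ G) →
    Der (((α , M ⇒ (B ∷ N)) ∷ X) ∷ G) →
    Der (((α , M ⇒ ((A ∧ᶠ B) ∷ N)) ∷ X) ∷ G)

  L□₁ : ∀ {G X α A M N} →
    Der (((α , ((□ A) ∷ A ∷ M) ⇒ N) ∷ X) ∷ G) →
    Der (((α , ((□ A) ∷ M) ⇒ N) ∷ X) ∷ G)

  R□ : ∀ {G X α A M N} →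
    Der (((α , M ⇒ N) ∷ X) ∷ ((α , [] ⇒ [ A ]) ∷ []) ∷ G) →
    Der (((α , M ⇒ ((□ A) ∷ N)) ∷ X) ∷ G)

  L□₂ : ∀ {G X Y α A M N P Q} →
    Der (((α , ((□ A) ∷ M) ⇒ N) ∷ X) ∷ ((α , (A ∷ P) ⇒ Q) ∷ Y) ∷ G) →
    Der (((α , ((□ A) ∷ M) ⇒ N) ∷ X) ∷ ((α , P ⇒ Q) ∷ Y) ∷ G)

  -- β = B₁ ∷ Bs (n ≥ 1), Γ = M ⇒ N, Ȳ = Y //_{α·β} □A, Δ  (Δ = Da ⇒ Ds)
  L□₃ : ∀ {G X Y α A B₁ Bs M N Da Ds} →
    Der (((α , M ⇒ (B₁ ∷ N)) ∷ X) ∷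
         ((α ++ (B₁ ∷ Bs) , ((□ A) ∷ Da) ⇒ Ds) ∷ Y) ∷ G) →
    (∀ {γ C} → (γ , C) ∈ prefixGoals (α ∷ʳ B₁) Bs →
      Der (((α , M ⇒ N) ∷ (γ , [] ⇒ [ C ]) ∷ X) ∷
           ((α ++ (B₁ ∷ Bs) , ((□ A) ∷ Da) ⇒ Ds) ∷ Y) ∷ G)) →
    Der (((α , M ⇒ N) ∷ (α ++ (B₁ ∷ Bs) , [ A ] ⇒ []) ∷ X) ∷
         ((α ++ (B₁ ∷ Bs) , ((□ A) ∷ Da) ⇒ Ds) ∷ Y) ∷ G) →
    Der (((α , M ⇒ N) ∷ X) ∷
         ((α ++ (B₁ ∷ Bs) , ((□ A) ∷ Da) ⇒ Ds) ∷ Y) ∷ G)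

  L[] : ∀ {G X α A B M N M' N'} →
    Der (((α , M ⇒ (A ∷ N)) ∷ (α ∷ʳ A , M' ⇒ N') ∷ X) ∷ G) →
    Der (((α , M ⇒ N) ∷ (α ∷ʳ A , (B ∷ M') ⇒ N') ∷ X) ∷ G) →
    Der (((α , ((⟦ A ⟧ B) ∷ M) ⇒ N) ∷ (α ∷ʳ A , M' ⇒ N') ∷ X) ∷ G)

  -- no α·A component in the conclusion: new one in the right premise
  L[]new : ∀ {G X α A B M N} → NoLabel (α ∷ʳ A) X →
    Der (((α , M ⇒ (A ∷ N)) ∷ X) ∷ G) →
    Der (((α , M ⇒ N) ∷ (α ∷ʳ A , [ B ] ⇒ []) ∷ X) ∷ G) →
    Der (((α , ((⟦ A ⟧ B) ∷ M) ⇒ N) ∷ X) ∷ G)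

  R[] : ∀ {G X α A B M N M' N'} →
    Der (((α , (A ∷ M) ⇒ N) ∷ (α ∷ʳ A , M' ⇒ (B ∷ N')) ∷ X) ∷ G) →
    Der (((α , M ⇒ ((⟦ A ⟧ B) ∷ N)) ∷ (α ∷ʳ A , M' ⇒ N') ∷ X) ∷ G)

  R[]new : ∀ {G X α A B M N} → NoLabel (α ∷ʳ A) X →
    Der (((α , (A ∷ M) ⇒ N) ∷ (α ∷ʳ A , [] ⇒ [ B ]) ∷ X) ∷ G) →
    Der (((α , M ⇒ ((⟦ A ⟧ B) ∷ N)) ∷ X) ∷ G)

  Lat : ∀ {G X α A p M N M' N'} →
    Der (((α , (at p ∷ M) ⇒ N) ∷ (α ∷ʳ A , (at p ∷ M') ⇒ N') ∷ X) ∷ G) →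
    Der (((α , M ⇒ N) ∷ (α ∷ʳ A , (at p ∷ M') ⇒ N') ∷ X) ∷ G)

  Rat : ∀ {G X α A p M N M' N'} →
    Der (((α , M ⇒ (at p ∷ N)) ∷ (α ∷ʳ A , M' ⇒ (at p ∷ N')) ∷ X) ∷ G) →
    Der (((α , M ⇒ N) ∷ (α ∷ʳ A , M' ⇒ (at p ∷ N')) ∷ X) ∷ G)

  New : ∀ {G X α A M N} →
    Der (((α , [] ⇒ []) ∷ (α ∷ʳ A , M ⇒ N) ∷ X) ∷ G) →
    Der (((α ∷ʳ A , M ⇒ N) ∷ X) ∷ G)

  Recall : ∀ {G X α A M N M' N'} →
    Der (((α , (A ∷ M) ⇒ N) ∷ (α ∷ʳ A , M' ⇒ N') ∷ X) ∷ G) →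
    Der (((α , M ⇒ N) ∷ (α ∷ʳ A , M' ⇒ N') ∷ X) ∷ G)

-- Induction on A, for all contexts at once.  A box □A on the right opens a new
-- dynamic sequent //_α ⇒ A by (R□), into which (L□₂) copies A from the left, so the
-- induction hypothesis applies there.  An announcement [A]B is handled by (R[·])
-- followed by (L[·]), which leaves A ⇒ A at label α and B ⇒ B at label α·A; this
-- needs a component labelled α·A, which is either already in X or is created by the
-- "new" variant of (R[·]).  Telling the two cases apart needs decidable equality of
-- formulas.
module Submission where

open import Defs
open import Data.List using (List; []; _∷_; [_]; _∷ʳ_)
open import Data.List.Properties using (≡-dec)
open import Data.List.Relation.Unary.Any using (Any; here; there; any?)
open import Data.List.Relation.Unary.All.Properties using (¬Any⇒All¬)
open import Data.List.Relation.Binary.Permutation.Homogeneous using (refl; prep; swap; trans)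
import Data.List.Relation.Binary.Permutation.Propositional as ↭
import Data.List.Relation.Binary.Pointwise.Properties as Pointwise
import Data.Nat.Properties as ℕ
open import Data.Product using (∃₂; _,_; proj₁)
open import Data.Sum using (_⊎_; inj₁; inj₂)
open import Relation.Binary.PropositionalEquality using (_≡_; refl)
open import Relation.Nullary using (Dec; yes; no)

infix 4 _≟ᶠ_
_≟ᶠ_ : (A B : Fm) → Dec (A ≡ B)
at p ≟ᶠ at q with p ℕ.≟ q
... | yes refl = yes refl
... | no p≢q   = no λ { refl → p≢q refl }
¬ᶠ A ≟ᶠ ¬ᶠ B with A ≟ᶠ B
... | yes refl = yes refl
... | no A≢B   = no λ { refl → A≢B refl }
A ∧ᶠ B ≟ᶠ C ∧ᶠ D with A ≟ᶠ C | B ≟ᶠ D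
... | yes refl | yes refl = yes refl
... | no A≢C   | _        = no λ { refl → A≢C refl }
... | _        | no B≢D   = no λ { refl → B≢D refl }
□ A ≟ᶠ □ B with A ≟ᶠ B
... | yes refl = yes refl
... | no A≢B   = no λ { refl → A≢B refl }
⟦ A ⟧ B ≟ᶠ ⟦ C ⟧ D with A ≟ᶠ C | B ≟ᶠ D
... | yes refl | yes refl = yes refl
... | no A≢C   | _        = no λ { refl → A≢C refl }
... | _        | no B≢D   = no λ { refl → B≢D refl }
at _    ≟ᶠ ¬ᶠ _    = no λ ()
at _    ≟ᶠ _ ∧ᶠ _  = no λ ()
at _    ≟ᶠ □ _     = no λ ()
at _    ≟ᶠ ⟦ _ ⟧ _ = no λ ()
¬ᶠ _    ≟ᶠ at _    = no λ ()
¬ᶠ _    ≟ᶠ _ ∧ᶠ _  = no λ ()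
¬ᶠ _    ≟ᶠ □ _     = no λ ()
¬ᶠ _    ≟ᶠ ⟦ _ ⟧ _ = no λ ()
_ ∧ᶠ _  ≟ᶠ at _    = no λ ()
_ ∧ᶠ _  ≟ᶠ ¬ᶠ _    = no λ ()
_ ∧ᶠ _  ≟ᶠ □ _     = no λ ()
_ ∧ᶠ _  ≟ᶠ ⟦ _ ⟧ _ = no λ ()
□ _     ≟ᶠ at _    = no λ ()
□ _     ≟ᶠ ¬ᶠ _    = no λ ()
□ _     ≟ᶠ _ ∧ᶠ _  = no λ ()
□ _     ≟ᶠ ⟦ _ ⟧ _ = no λ ()
⟦ _ ⟧ _ ≟ᶠ at _    = no λ ()
⟦ _ ⟧ _ ≟ᶠ ¬ᶠ _    = no λ ()
⟦ _ ⟧ _ ≟ᶠ _ ∧ᶠ _  = no λ ()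
⟦ _ ⟧ _ ≟ᶠ □ _     = no λ ()

CompEq-refl : ∀ {c} → CompEq c c
CompEq-refl {_ , _ ⇒ _} = compEq (seqEq ↭.refl ↭.refl)

DynEq-refl : ∀ {X} → DynEq X X
DynEq-refl = refl (Pointwise.refl CompEq-refl)

DHSEq-refl : ∀ {G} → DHSEq G G
DHSEq-refl = refl (Pointwise.refl DynEq-refl)

Der-resp-DynEq : ∀ {G X Y} → DynEq X Y → Der (X ∷ G) → Der (Y ∷ G)
Der-resp-DynEq X≈Y d = perm d (prep X≈Y DHSEq-refl)

Der-resp-CompEq : ∀ {G X c d} → CompEq c d → Der ((c ∷ X) ∷ G) → Der ((d ∷ X) ∷ G)
Der-resp-CompEq c≈d = Der-resp-DynEq (prep c≈d DynEq-refl)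

Der-swapˡ : ∀ {G X α A B M N} →
  Der (((α , (A ∷ B ∷ M) ⇒ N) ∷ X) ∷ G) → Der (((α , (B ∷ A ∷ M) ⇒ N) ∷ X) ∷ G)
Der-swapˡ {A = A} {B} = Der-resp-CompEq (compEq (seqEq (↭.swap A B ↭.refl) ↭.refl))

Der-swapʳ : ∀ {G X α A B M N} →
  Der (((α , M ⇒ (A ∷ B ∷ N)) ∷ X) ∷ G) → Der (((α , M ⇒ (B ∷ A ∷ N)) ∷ X) ∷ G)
Der-swapʳ {A = A} {B} = Der-resp-CompEq (compEq (seqEq ↭.refl (↭.swap A B ↭.refl)))

Der-swapComp : ∀ {G X c d} → Der ((c ∷ d ∷ X) ∷ G) → Der ((d ∷ c ∷ X) ∷ G)
Der-swapComp = Der-resp-DynEq (swap CompEq-refl CompEq-refl DynEq-refl)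

Der-swapDyn : ∀ {G X Y} → Der (X ∷ Y ∷ G) → Der (Y ∷ X ∷ G)
Der-swapDyn d = perm d (swap DynEq-refl DynEq-refl DHSEq-refl)

HasLabel : Label → Dyn → Set
HasLabel γ = Any (λ c → proj₁ c ≡ γ)

HasLabel⇒focus : ∀ {γ} (X : Dyn) → HasLabel γ X →
  ∃₂ λ (s : Seq) (X' : Dyn) → DynEq ((γ , s) ∷ X') X
HasLabel⇒focus ((_ , s) ∷ X) (here refl) = s , X , DynEq-refl
HasLabel⇒focus (c ∷ X) (there γ∈X) with HasLabel⇒focus X γ∈X
... | s , X' , X≈ = s , c ∷ X' , trans (swap CompEq-refl CompEq-refl DynEq-refl) (prep CompEq-refl X≈)

NoLabel⊎focus : (γ : Label) (X : Dyn) →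
  NoLabel γ X ⊎ (∃₂ λ (s : Seq) (X' : Dyn) → DynEq ((γ , s) ∷ X') X)
NoLabel⊎focus γ X with any? (λ c → ≡-dec _≟ᶠ_ (proj₁ c) γ) X
... | no ¬γ∈X = inj₁ (¬Any⇒All¬ X ¬γ∈X)
... | yes γ∈X = inj₂ (HasLabel⇒focus X γ∈X)

mainTheorem5 : (G : DHS) (X : Dyn) (α : Label) (A : Fm) (M N : List Fm) →
    Der (((α , (A ∷ M) ⇒ (A ∷ N)) ∷ X) ∷ G)
mainTheorem5 G X α (at p) M N = ax
mainTheorem5 G X α (¬ᶠ A) M N = L¬ (Der-swapʳ (R¬ (mainTheorem5 G X α A M N)))
mainTheorem5 G X α (A ∧ᶠ B) M N =
  L∧ (R∧ (mainTheorem5 G X α A (B ∷ M) N) (Der-swapˡ (mainTheorem5 G X α B (A ∷ M) N)))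
mainTheorem5 G X α (□ A) M N =
  R□ (L□₂ {Y = []} (Der-swapDyn (mainTheorem5 (((α , (□ A ∷ M) ⇒ N) ∷ X) ∷ G) [] α A [] [])))
mainTheorem5 G X α (⟦ A ⟧ B) M N with NoLabel⊎focus (α ∷ʳ A) X
... | inj₁ noα·A =
  R[]new noα·A (Der-swapˡ (L[] (mainTheorem5 G ((α ∷ʳ A , [] ⇒ [ B ]) ∷ X) α A M N)
                                (Der-swapComp (mainTheorem5 G ((α , (A ∷ M) ⇒ N) ∷ X) (α ∷ʳ A) B [] []))))
... | inj₂ ((M' ⇒ N') , X' , X≈) =
  Der-resp-DynEq (prep CompEq-refl X≈)
    (R[] (Der-swapˡ (L[] (mainTheorem5 G ((α ∷ʳ A , M' ⇒ (B ∷ N')) ∷ X') α A M N)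
                         (Der-swapComp (mainTheorem5 G ((α , (A ∷ M) ⇒ N) ∷ X') (α ∷ʳ A) B M' N')))))
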